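{- If vertices $v,w,x,y$ span a diamond in $G\in\mathcal{G}_n$, then there is a path of length at most two in $\mathcal{G}_n^*$ from $G$ to a graph $G'\in\mathcal{G}_n$ in which $v,w,x,y$ induce a connected component isomorphic to $K_4$.
   Context: $\mathcal{G}_n$ is the set of simple 3-regular graphs on vertex set $[n]$, $n\ge4$ even. A make move ${\tt make}(yxvwz)$ applies to $G=(V,E)$ when $y,x,v,w,z$ are distinct, $yx,xv,vw,wz\in E$ and $xw,yz\notin E$, and replaces $E$ by $(E\setminus\{xy,wz\})\cup\{xw,yz\}$. A break move ${\tt break}(vxw,yz)$ applies when $vxwv$ is a triangle, $yz\in E$, $\{y,z\}\cap\{v,x,w\}=\emptyset$ and $xy,wz\notin E$, and replaces $E$ by $(E\setminus\{xw,yz\})\cup\{xy,wz\}$. $\mathcal{G}_n^*$ is the graph on vertex set $\mathcal{G}_n$ with $G,G'$ adjacent iff a make or break move takes $G$ to $G'$. A diamond is $K_4$ minus one edge. -}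

module Defs where

open import Data.Nat using (ℕ; _≤_)
open import Data.Nat.Divisibility using (_∣_)
open import Data.Bool using (Bool; true; false)
open import Data.Fin using (Fin)
open import Data.Fin.Subset using (Subset; ∣_∣)
open import Data.Vec using (Vec; tabulate; lookup; _∷_; [])
open import Data.Product using (_×_; Σ; ∃; _,_)
open import Data.Sum using (_⊎_)
open import Relation.Nullary using (¬_)
open import Relation.Binary.PropositionalEquality using (_≡_; _≢_)
open import Function.Bundles using (_⇔_)

-- A (labelled) graph on vertex set [n] = Fin n, given by its adjacency
-- function: row i is the subset of neighbours of i.
Graph : ℕ → Set
Graph n = Fin n → Subset n

Edge : ∀ {n} → Graph n → Fin n → Fin n → Set
Edge G u v = lookup (G u) v ≡ true

record Cubic {n : ℕ} (G : Graph n) : Set where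
  field
    loopless : ∀ u → lookup (G u) u ≡ false
    symmetric : ∀ u v → lookup (G u) v ≡ lookup (G v) u
    regular : ∀ u → ∣ G u ∣ ≡ 3

SamePair : ∀ {n} → Fin n → Fin n → Fin n → Fin n → Set
SamePair a b x y = ((a ≡ x) × (b ≡ y)) ⊎ ((a ≡ y) × (b ≡ x))

Switched : ∀ {n} → Graph n → Graph n →
           (p q s t c d e f : Fin n) → Set
Switched G G' p q s t c d e f =
  ∀ a b → Edge G' a b ⇔
    ((Edge G a b × ¬ SamePair a b p q × ¬ SamePair a b s t)
     ⊎ SamePair a b c d ⊎ SamePair a b e f)

Distinct5 : ∀ {n} → (a b c d e : Fin n) → Set
Distinct5 a b c d e =
  a ≢ b × a ≢ c × a ≢ d × a ≢ e × b ≢ c × b ≢ d × b ≢ e ×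
  c ≢ d × c ≢ e × d ≢ e

MakeMove : ∀ {n} → Graph n → Graph n → (y x v w z : Fin n) → Set
MakeMove G G' y x v w z =
  Distinct5 y x v w z ×
  Edge G y x × Edge G x v × Edge G v w × Edge G w z ×
  ¬ Edge G x w × ¬ Edge G y z ×
  Switched G G' x y w z x w y z

BreakMove : ∀ {n} → Graph n → Graph n → (v x w y z : Fin n) → Set
BreakMove G G' v x w y z =
  Distinct5 v x w y z ×
  Edge G v x × Edge G x w × Edge G w v × Edge G y z ×
  ¬ Edge G x y × ¬ Edge G w z ×
  Switched G G' x w y z x y w z

Move : ∀ {n} → Graph n → Graph n → Set
Move {n} G G' =
  (Σ (Fin n) λ a → Σ (Fin n) λ b → Σ (Fin n) λ c → Σ (Fin n) λ d →
     Σ (Fin n) λ e → MakeMove G G' a b c d e)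
  ⊎
  (Σ (Fin n) λ a → Σ (Fin n) λ b → Σ (Fin n) λ c → Σ (Fin n) λ d →
     Σ (Fin n) λ e → BreakMove G G' a b c d e)

SameGraph : ∀ {n} → Graph n → Graph n → Set
SameGraph G G' = ∀ a b → lookup (G a) b ≡ lookup (G' a) b

PathLe2 : ∀ {n} → Graph n → Graph n → Set
PathLe2 {n} G G' =
  SameGraph G G' ⊎ Move G G' ⊎
  (Σ (Graph n) λ H → Cubic H × Move G H × Move H G')

Distinct4 : ∀ {n} → (a b c d : Fin n) → Set
Distinct4 a b c d = a ≢ b × a ≢ c × a ≢ d × b ≢ c × b ≢ d × c ≢ d

pairBits : ∀ {n} → Graph n → (v w x y : Fin n) → Vec Bool 6
pairBits G v w x y =
  lookup (G v) w ∷ lookup (G v) x ∷ lookup (G v) y ∷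
  lookup (G w) x ∷ lookup (G w) y ∷ lookup (G x) y ∷ []

-- v,w,x,y span a diamond: distinct, and exactly 5 of the 6 pairs are edges
-- (i.e. the induced subgraph is K₄ minus one edge)
Diamond : ∀ {n} → Graph n → (v w x y : Fin n) → Set
Diamond G v w x y = Distinct4 v w x y × ∣ pairBits G v w x y ∣ ≡ 5

InQuad : ∀ {n} → (v w x y u : Fin n) → Set
InQuad v w x y u = u ≡ v ⊎ u ≡ w ⊎ u ≡ x ⊎ u ≡ y

K4Component : ∀ {n} → Graph n → (v w x y : Fin n) → Set
K4Component G v w x y =
  Distinct4 v w x y ×
  Edge G v w × Edge G v x × Edge G v y ×
  Edge G w x × Edge G w y × Edge G x y ×
  (∀ a b → InQuad v w x y a → Edge G a b → InQuad v w x y b)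

module Submission where

-- Let a, b, c, d span a diamond in a
-- cubic graph G, with tips a, b (the non-adjacent pair) and spine c, d. Then
-- N(c) = {a, b, d}, N(d) = {a, b, c}, and each tip has one further neighbour,
-- a′ of a and b′ of b. If a′ ≠ b′ are non-adjacent, make(a′ a c b b′) replaces
-- aa′, bb′ by ab, a′b′ and makes {a, b, c, d} complete. If a′ = b′, or a′ ~ b′,
-- one preparatory make move along a short path leaving the diamond produces a
-- cubic graph with the same diamond and with such joinable exits. Finally, four
-- pairwise adjacent vertices of a cubic graph form a K₄ component.

open import Defs
open import Data.Nat using (ℕ; suc; _≤_; z≤n; s≤s)
open import Data.Nat.Properties using (≤-trans; ≤-reflexive; n≤1+n; suc-injective; module ≤-Reasoning)
open import Data.Nat.Divisibility using (_∣_)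
open import Data.Bool using (Bool; true; false)
open import Data.Bool.Properties using (¬-not; not-¬) renaming (_≟_ to _≟ᵇ_)
open import Data.Fin using (Fin; zero; suc; #_)
open import Data.Fin.Properties using (_≟_; any?)
open import Data.Fin.Subset using (Subset; ∣_∣; ⊥)
open import Data.Fin.Subset.Properties using (∣⊥∣≡0; ∣p∣≡n⇒p≡⊤)
open import Data.Vec using (Vec; lookup; _∷_; _[_]≔_; tabulate)
open import Data.Vec.Properties using (lookup∘tabulate; tabulate∘lookup; tabulate-cong; lookup∘update; lookup∘update′; lookup-replicate)
open import Data.List using (List; length) renaming (_∷_ to _∷ₗ_; [] to []ₗ)
open import Data.List.Relation.Unary.All as All using (All)
open import Data.List.Relation.Unary.Any using (here; there)
open import Data.List.Relation.Unary.Unique.Propositional using (Unique)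
import Data.List.Relation.Unary.AllPairs as AllPairs
open import Data.List.Membership.Propositional using (_∈_)
open import Data.Product using (_×_; Σ; ∃; _,_; proj₁; proj₂)
open import Data.Sum using (_⊎_; inj₁; inj₂; [_,_]′; map₂)
open import Relation.Nullary using (¬_; Dec; yes; no; ¬?; contradiction)
open import Relation.Nullary.Decidable using (_×-dec_; _⊎-dec_)
open import Relation.Binary.PropositionalEquality
open import Function using (_∘_)
open import Function.Bundles using (mk⇔; Equivalence)

private
  variable
    n : ℕ

vec-ext : (r r' : Vec Bool n) → (∀ k → lookup r k ≡ lookup r' k) → r ≡ r'
vec-ext r r' h = trans (sym (tabulate∘lookup r)) (trans (tabulate-cong h) (tabulate∘lookup r'))

∣clear∣ : (r : Subset n) (i : Fin n) → lookup r i ≡ true → ∣ r ∣ ≡ suc ∣ r [ i ]≔ false ∣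
∣clear∣ (true ∷ r) zero refl = refl
∣clear∣ (true ∷ r) (suc i) e = cong suc (∣clear∣ r i e)
∣clear∣ (false ∷ r) (suc i) e = ∣clear∣ r i e

∣clear∣-≤ : (r : Subset n) (i : Fin n) → ∣ r ∣ ≤ suc ∣ r [ i ]≔ false ∣
∣clear∣-≤ r i with lookup r i in e
... | true = ≤-reflexive (∣clear∣ r i e)
... | false = ≤-trans (≤-reflexive (cong ∣_∣ (vec-ext r (r [ i ]≔ false) same))) (n≤1+n _)
  where
  same : ∀ k → lookup r k ≡ lookup (r [ i ]≔ false) k
  same k with k ≟ i
  ... | yes refl = trans e (sym (lookup∘update i r false))
  ... | no k≢i = sym (lookup∘update′ k≢i r false)

members-≤ : (r : Subset n) (xs : List (Fin n)) → Unique xs →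
            All (λ i → lookup r i ≡ true) xs → length xs ≤ ∣ r ∣
members-≤ r []ₗ _ _ = z≤n
members-≤ r (x ∷ₗ xs) (x∉xs AllPairs.∷ uq) (rx All.∷ rxs) = begin
  suc (length xs)             ≤⟨ s≤s (members-≤ (r [ x ]≔ false) xs uq remaining) ⟩
  suc ∣ r [ x ]≔ false ∣      ≡⟨ sym (∣clear∣ r x rx) ⟩
  ∣ r ∣                       ∎
  where
  open ≤-Reasoning
  remaining : All (λ i → lookup (r [ x ]≔ false) i ≡ true) xs
  remaining = All.zipWith (λ (x≢i , ri) → trans (lookup∘update′ (≢-sym x≢i) r false) ri) (x∉xs , rxs)

≤-members : (r : Subset n) (xs : List (Fin n)) →
            (∀ i → lookup r i ≡ true → i ∈ xs) → ∣ r ∣ ≤ length xs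
≤-members {n} r []ₗ covers = ≤-reflexive (trans (cong ∣_∣ (vec-ext r ⊥ empty)) (∣⊥∣≡0 n))
  where
  empty : ∀ k → lookup r k ≡ lookup ⊥ k
  empty k with lookup r k in e
  ... | true with () ← covers k e
  ... | false = sym (lookup-replicate k false)
≤-members r (x ∷ₗ xs) covers = ≤-trans (∣clear∣-≤ r x) (s≤s (≤-members (r [ x ]≔ false) xs covers′))
  where
  covers′ : ∀ i → lookup (r [ x ]≔ false) i ≡ true → i ∈ xs
  covers′ i e with i ≟ x
  ... | yes refl = contradiction (trans (sym (lookup∘update x r false)) e) λ ()
  ... | no i≢x with covers i (trans (sym (lookup∘update′ i≢x r false)) e)
  ...   | here i≡x = contradiction i≡x i≢x
  ...   | there i∈xs = i∈xs

∣swap∣ : (r r' : Subset n) (Q R : Fin n) → Q ≢ R →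
         lookup r Q ≡ true → lookup r R ≡ false →
         lookup r' Q ≡ false → lookup r' R ≡ true →
         (∀ k → k ≢ Q → k ≢ R → lookup r' k ≡ lookup r k) → ∣ r' ∣ ≡ ∣ r ∣
∣swap∣ r r' Q R Q≢R rQ rR r'Q r'R elsewhere = begin
  ∣ r' ∣                  ≡⟨ ∣clear∣ r' R r'R ⟩
  suc ∣ r' [ R ]≔ false ∣ ≡⟨ cong (suc ∘ ∣_∣) (vec-ext (r' [ R ]≔ false) (r [ Q ]≔ false) agree) ⟩
  suc ∣ r [ Q ]≔ false ∣  ≡⟨ sym (∣clear∣ r Q rQ) ⟩
  ∣ r ∣                   ∎
  where
  open ≡-Reasoning
  agree : ∀ k → lookup (r' [ R ]≔ false) k ≡ lookup (r [ Q ]≔ false) k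
  agree k with k ≟ Q | k ≟ R
  ... | yes refl | _ = trans (lookup∘update′ Q≢R r' false) (trans r'Q (sym (lookup∘update Q r false)))
  ... | no _ | yes refl = trans (lookup∘update R r' false) (trans (sym rR) (sym (lookup∘update′ (≢-sym Q≢R) r false)))
  ... | no k≢Q | no k≢R = trans (lookup∘update′ k≢R r' false)
                            (trans (elsewhere k k≢Q k≢R) (sym (lookup∘update′ k≢Q r false)))

third-member : (r : Subset n) → ∣ r ∣ ≡ 3 → ∀ i j → ∃ λ k → lookup r k ≡ true × k ≢ i × k ≢ j
third-member r ∣r∣≡3 i j with any? (λ k → (lookup r k ≟ᵇ true) ×-dec (¬? (k ≟ i) ×-dec ¬? (k ≟ j)))
... | yes found = found
... | no none =
  contradiction (≤-trans (≤-reflexive (sym ∣r∣≡3)) (≤-members r (i ∷ₗ j ∷ₗ []ₗ) inside)) λ { (s≤s (s≤s ())) }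
  where
  inside : ∀ k → lookup r k ≡ true → k ∈ i ∷ₗ j ∷ₗ []ₗ
  inside k rk with k ≟ i | k ≟ j
  ... | yes k≡i | _ = here k≡i
  ... | no _ | yes k≡j = there (here k≡j)
  ... | no k≢i | no k≢j = contradiction (k , rk , k≢i , k≢j) none

only-three : (r : Subset n) → ∣ r ∣ ≡ 3 → ∀ {i j k} → i ≢ j → i ≢ k → j ≢ k →
             lookup r i ≡ true → lookup r j ≡ true → lookup r k ≡ true →
             ∀ l → lookup r l ≡ true → l ≡ i ⊎ l ≡ j ⊎ l ≡ k
only-three r ∣r∣≡3 {i} {j} {k} i≢j i≢k j≢k ri rj rk l rl with l ≟ i | l ≟ j | l ≟ k
... | yes l≡i | _ | _ = inj₁ l≡i
... | no _ | yes l≡j | _ = inj₂ (inj₁ l≡j)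
... | no _ | no _ | yes l≡k = inj₂ (inj₂ l≡k)
... | no l≢i | no l≢j | no l≢k =
  contradiction (≤-trans (members-≤ r (l ∷ₗ i ∷ₗ j ∷ₗ k ∷ₗ []ₗ) distinct members) (≤-reflexive ∣r∣≡3))
                λ { (s≤s (s≤s (s≤s ()))) }
  where
  distinct : Unique (l ∷ₗ i ∷ₗ j ∷ₗ k ∷ₗ []ₗ)
  distinct = (l≢i All.∷ l≢j All.∷ l≢k All.∷ All.[]) AllPairs.∷ (i≢j All.∷ i≢k All.∷ All.[]) AllPairs.∷
             (j≢k All.∷ All.[]) AllPairs.∷ All.[] AllPairs.∷ AllPairs.[]
  members : All (λ x → lookup r x ≡ true) (l ∷ₗ i ∷ₗ j ∷ₗ k ∷ₗ []ₗ)
  members = rl All.∷ ri All.∷ rj All.∷ rk All.∷ All.[]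

single-zero : ∀ {m} (bs : Vec Bool (suc m)) → ∣ bs ∣ ≡ m →
              ∃ λ i → lookup bs i ≡ false × (∀ j → j ≢ i → lookup bs j ≡ true)
single-zero (false ∷ bs) ∣bs∣≡m = zero , refl , rest
  where
  rest : ∀ j → j ≢ zero → lookup (false ∷ bs) j ≡ true
  rest zero 0≢0 = contradiction refl 0≢0
  rest (suc j) _ = trans (cong (λ bs → lookup bs j) (∣p∣≡n⇒p≡⊤ {p = bs} ∣bs∣≡m)) (lookup-replicate j true)
single-zero {suc m} (true ∷ bs) ∣bs∣≡m with single-zero bs (suc-injective ∣bs∣≡m)
... | i , zero-at-i , ones = suc i , zero-at-i , rest
  where
  rest : ∀ j → j ≢ suc i → lookup (true ∷ bs) j ≡ true
  rest zero _ = refl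
  rest (suc j) j≢i = ones j (j≢i ∘ cong suc)

bool-ext : {x y : Bool} → (x ≡ true → y ≡ true) → (y ≡ true → x ≡ true) → x ≡ y
bool-ext {true} to _ = sym (to refl)
bool-ext {false} {true} _ from = from refl
bool-ext {false} {false} _ _ = refl

edge-sym : {G : Graph n} → Cubic G → ∀ {u v} → Edge G u v → Edge G v u
edge-sym cub {u} {v} e = trans (Cubic.symmetric cub v u) e

edge-≢ : {G : Graph n} → Cubic G → ∀ {u v} → Edge G u v → u ≢ v
edge-≢ cub {u} e refl = not-¬ (Cubic.loopless cub u) e

samePair? : (a b x y : Fin n) → Dec (SamePair a b x y)
samePair? a b x y = ((a ≟ x) ×-dec (b ≟ y)) ⊎-dec ((a ≟ y) ×-dec (b ≟ x))

SamePair-swap : {a b x y : Fin n} → SamePair a b x y → SamePair b a x y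
SamePair-swap (inj₁ (a≡x , b≡y)) = inj₂ (b≡y , a≡x)
SamePair-swap (inj₂ (a≡y , b≡x)) = inj₁ (b≡x , a≡y)

≢pair : {a b x y : Fin n} → (a ≢ x ⊎ b ≢ y) → (a ≢ y ⊎ b ≢ x) → ¬ SamePair a b x y
≢pair (inj₁ a≢x) _ (inj₁ (a≡x , _)) = a≢x a≡x
≢pair (inj₂ b≢y) _ (inj₁ (_ , b≡y)) = b≢y b≡y
≢pair _ (inj₁ a≢y) (inj₂ (a≡y , _)) = a≢y a≡y
≢pair _ (inj₂ b≢x) (inj₂ (_ , b≡x)) = b≢x b≡x

≢pairˡ : {a b x y : Fin n} → a ≢ x → a ≢ y → ¬ SamePair a b x y
≢pairˡ a≢x a≢y = ≢pair (inj₁ a≢x) (inj₁ a≢y)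

≢pairʳ : {a b x y : Fin n} → b ≢ x → b ≢ y → ¬ SamePair a b x y
≢pairʳ b≢x b≢y = ≢pair (inj₂ b≢y) (inj₂ b≢x)

≢pair-fst : {a b x y : Fin n} → a ≢ x → b ≢ x → ¬ SamePair a b x y
≢pair-fst a≢x b≢x = ≢pair (inj₁ a≢x) (inj₂ b≢x)

≢pair-snd : {a b x y : Fin n} → a ≢ y → b ≢ y → ¬ SamePair a b x y
≢pair-snd a≢y b≢y = ≢pair (inj₂ b≢y) (inj₁ a≢y)

AfterSwitch : Graph n → (p q s t c d e f a b : Fin n) → Set
AfterSwitch G p q s t c d e f a b =
  (Edge G a b × ¬ SamePair a b p q × ¬ SamePair a b s t) ⊎ SamePair a b c d ⊎ SamePair a b e f

switchEntry : {P Q : Set} → Dec P → Dec Q → Bool → Bool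
switchEntry (yes _) _ _ = true
switchEntry (no _) (yes _) _ = false
switchEntry (no _) (no _) b = b

switch : Graph n → (A B C D : Fin n) → Graph n
switch G A B C D u = tabulate λ k →
  switchEntry (samePair? u k A C ⊎-dec samePair? u k B D)
              (samePair? u k A B ⊎-dec samePair? u k C D) (lookup (G u) k)

switch-spec : (G : Graph n) (A B C D : Fin n) → Switched G (switch G A B C D) A B C D A C B D
switch-spec G A B C D u k
  rewrite lookup∘tabulate (λ k → switchEntry (samePair? u k A C ⊎-dec samePair? u k B D)
                                   (samePair? u k A B ⊎-dec samePair? u k C D) (lookup (G u) k)) k
  with samePair? u k A C ⊎-dec samePair? u k B D | samePair? u k A B ⊎-dec samePair? u k C D
... | yes (inj₁ new) | _ = mk⇔ (λ _ → inj₂ (inj₁ new)) (λ _ → refl)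
... | yes (inj₂ new) | _ = mk⇔ (λ _ → inj₂ (inj₂ new)) (λ _ → refl)
... | no old | yes gone = mk⇔ (λ ()) from
  where
  from : AfterSwitch G A B C D A C B D u k → false ≡ true
  from (inj₁ (_ , ¬AB , ¬CD)) = contradiction gone [ ¬AB , ¬CD ]′
  from (inj₂ new) = contradiction new old
... | no old | no kept = mk⇔ (λ e → inj₁ (e , kept ∘ inj₁ , kept ∘ inj₂)) from
  where
  from : AfterSwitch G A B C D A C B D u k → lookup (G u) k ≡ true
  from (inj₁ (e , _ , _)) = e
  from (inj₂ new) = contradiction new old

module SwitchFacts (G G' : Graph n) {p q s t c d e f : Fin n} (S : Switched G G' p q s t c d e f) where

  kept : ∀ {a b} → Edge G a b → ¬ SamePair a b p q → ¬ SamePair a b s t → Edge G' a b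
  kept {a} {b} e ¬pq ¬st = Equivalence.from (S a b) (inj₁ (e , ¬pq , ¬st))

  inserted₁ : Edge G' c d
  inserted₁ = Equivalence.from (S c d) (inj₂ (inj₁ (inj₁ (refl , refl))))

  inserted₂ : Edge G' e f
  inserted₂ = Equivalence.from (S e f) (inj₂ (inj₂ (inj₁ (refl , refl))))

  restored : ∀ {a b} → Edge G' a b → ¬ SamePair a b c d → ¬ SamePair a b e f → Edge G a b
  restored {a} {b} e' ¬cd ¬ef with Equivalence.to (S a b) e'
  ... | inj₁ (e , _ , _) = e
  ... | inj₂ (inj₁ cd) = contradiction cd ¬cd
  ... | inj₂ (inj₂ ef) = contradiction ef ¬ef

  absent : ∀ {a b} → ¬ Edge G a b → ¬ SamePair a b c d → ¬ SamePair a b e f → ¬ Edge G' a b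
  absent ¬e ¬cd ¬ef e' = ¬e (restored e' ¬cd ¬ef)

  deleted₁ : ¬ SamePair p q c d → ¬ SamePair p q e f → ¬ Edge G' p q
  deleted₁ ¬cd ¬ef e' with Equivalence.to (S p q) e'
  ... | inj₁ (_ , ¬pq , _) = ¬pq (inj₁ (refl , refl))
  ... | inj₂ (inj₁ cd) = contradiction cd ¬cd
  ... | inj₂ (inj₂ ef) = contradiction ef ¬ef

  deleted₂ : ¬ SamePair s t c d → ¬ SamePair s t e f → ¬ Edge G' s t
  deleted₂ ¬cd ¬ef e' with Equivalence.to (S s t) e'
  ... | inj₁ (_ , _ , ¬st) = ¬st (inj₁ (refl , refl))
  ... | inj₂ (inj₁ cd) = contradiction cd ¬cd
  ... | inj₂ (inj₂ ef) = contradiction ef ¬ef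

  unchanged : ∀ {a b} → ¬ SamePair a b p q → ¬ SamePair a b s t →
              ¬ SamePair a b c d → ¬ SamePair a b e f → lookup (G' a) b ≡ lookup (G a) b
  unchanged ¬pq ¬st ¬cd ¬ef = bool-ext (λ e' → restored e' ¬cd ¬ef) (λ e → kept e ¬pq ¬st)

  symmetric : Cubic G → ∀ {a b} → Edge G' a b → Edge G' b a
  symmetric cub {a} {b} e' with Equivalence.to (S a b) e'
  ... | inj₁ (e , ¬pq , ¬st) = kept (edge-sym cub e) (¬pq ∘ SamePair-swap) (¬st ∘ SamePair-swap)
  ... | inj₂ (inj₁ cd) = Equivalence.from (S b a) (inj₂ (inj₁ (SamePair-swap cd)))
  ... | inj₂ (inj₂ ef) = Equivalence.from (S b a) (inj₂ (inj₂ (SamePair-swap ef)))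

¬loop-pair : {u x y : Fin n} → x ≢ y → ¬ SamePair u u x y
¬loop-pair x≢y (inj₁ (u≡x , u≡y)) = x≢y (trans (sym u≡x) u≡y)
¬loop-pair x≢y (inj₂ (u≡y , u≡x)) = x≢y (trans (sym u≡x) u≡y)

-- Switching the edges {A,B}, {C,D} of a cubic graph into the non-edges
-- {A,C}, {B,D} yields a cubic graph: each of A, B, C, D trades exactly one
-- neighbour for another, and all other rows are untouched.
switch-cubic : {G G' : Graph n} {A B C D : Fin n} → Cubic G → Switched G G' A B C D A C B D →
               Distinct4 A B C D → Edge G A B → Edge G C D → ¬ Edge G A C → ¬ Edge G B D → Cubic G'
switch-cubic {n} {G} {G'} {A} {B} {C} {D} cub S (A≢B , A≢C , A≢D , B≢C , B≢D , C≢D) eAB eCD ¬AC ¬BD = record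
  { loopless = λ u → ¬-not (absent (λ e → edge-≢ cub e refl) (¬loop-pair A≢C) (¬loop-pair B≢D))
  ; symmetric = λ u v → bool-ext (symmetric cub) (symmetric cub)
  ; regular = λ u → trans (degree u) (Cubic.regular cub u)
  }
  where
  open SwitchFacts G G' S

  trade : ∀ u Q R → Q ≢ R → Edge G u Q → ¬ Edge G u R → ¬ Edge G' u Q → Edge G' u R →
          (∀ k → k ≢ Q → k ≢ R → lookup (G' u) k ≡ lookup (G u) k) → ∣ G' u ∣ ≡ ∣ G u ∣
  trade u Q R Q≢R uQ ¬uR ¬uQ' uR' = ∣swap∣ (G u) (G' u) Q R Q≢R uQ (¬-not ¬uR) (¬-not ¬uQ') uR'

  AB-deleted : ¬ Edge G' A B
  AB-deleted = deleted₁ (≢pair (inj₂ B≢C) (inj₁ A≢C)) (≢pairˡ A≢B A≢D)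

  CD-deleted : ¬ Edge G' C D
  CD-deleted = deleted₂ (≢pair (inj₁ (≢-sym A≢C)) (inj₂ (≢-sym A≢D))) (≢pairˡ (≢-sym B≢C) C≢D)

  degree : ∀ u → ∣ G' u ∣ ≡ ∣ G u ∣
  degree u with u ≟ A | u ≟ B | u ≟ C | u ≟ D
  ... | yes refl | _ | _ | _ =
    trade A B C B≢C eAB ¬AC AB-deleted inserted₁ λ k k≢B k≢C →
      unchanged (≢pair (inj₂ k≢B) (inj₁ A≢B)) (≢pairˡ A≢C A≢D)
                (≢pair (inj₂ k≢C) (inj₁ A≢C)) (≢pairˡ A≢B A≢D)
  ... | no _ | yes refl | _ | _ =
    trade B A D A≢D (edge-sym cub eAB) ¬BD (AB-deleted ∘ symmetric cub) inserted₂ λ k k≢A k≢D →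
      unchanged (≢pair (inj₁ (≢-sym A≢B)) (inj₂ k≢A)) (≢pairˡ B≢C B≢D)
                (≢pairˡ (≢-sym A≢B) B≢C) (≢pair (inj₂ k≢D) (inj₁ B≢D))
  ... | no _ | no _ | yes refl | _ =
    trade C D A (≢-sym A≢D) eCD (¬AC ∘ edge-sym cub) CD-deleted (symmetric cub inserted₁) λ k k≢D k≢A →
      unchanged (≢pairˡ (≢-sym A≢C) (≢-sym B≢C)) (≢pair (inj₂ k≢D) (inj₁ C≢D))
                (≢pair (inj₁ (≢-sym A≢C)) (inj₂ k≢A)) (≢pairˡ (≢-sym B≢C) C≢D)
  ... | no _ | no _ | no _ | yes refl =
    trade D C B (≢-sym B≢C) (edge-sym cub eCD) (¬BD ∘ edge-sym cub) (CD-deleted ∘ symmetric cub)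
          (symmetric cub inserted₂) λ k k≢C k≢B →
      unchanged (≢pairˡ (≢-sym A≢D) (≢-sym B≢D)) (≢pair (inj₁ (≢-sym C≢D)) (inj₂ k≢C))
                (≢pairˡ (≢-sym A≢D) (≢-sym C≢D)) (≢pair (inj₁ (≢-sym B≢D)) (inj₂ k≢B))
  ... | no u≢A | no u≢B | no u≢C | no u≢D =
    cong ∣_∣ (vec-ext (G' u) (G u) λ k →
      unchanged (≢pairˡ u≢A u≢B) (≢pairˡ u≢C u≢D) (≢pairˡ u≢A u≢C) (≢pairˡ u≢B u≢D))

make : {G : Graph n} → Cubic G → ∀ {y x v w z} → Distinct5 y x v w z →
       Edge G y x → Edge G x v → Edge G v w → Edge G w z → ¬ Edge G x w → ¬ Edge G y z →
       Cubic (switch G x y w z) × Move G (switch G x y w z)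
make {G = G} cub {y} {x} {v} {w} {z} dist@(y≢x , _ , y≢w , y≢z , _ , x≢w , x≢z , _ , _ , w≢z) yx xv vw wz ¬xw ¬yz =
  switch-cubic cub S (≢-sym y≢x , x≢w , x≢z , y≢w , y≢z , w≢z) (edge-sym cub yx) wz ¬xw ¬yz ,
  inj₁ (y , x , v , w , z , dist , yx , xv , vw , wz , ¬xw , ¬yz , S)
  where
  S : Switched G (switch G x y w z) x y w z x w y z
  S = switch-spec G x y w z

record NeighboursAre (G : Graph n) (u i j k : Fin n) : Set where
  constructor neighbours-are
  field
    among : ∀ l → Edge G u l → l ≡ i ⊎ l ≡ j ⊎ l ≡ k

neighbours : {G : Graph n} → Cubic G → ∀ u {i j k} → i ≢ j → i ≢ k → j ≢ k →
             Edge G u i → Edge G u j → Edge G u k → NeighboursAre G u i j k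
neighbours {G = G} cub u i≢j i≢k j≢k ui uj uk =
  neighbours-are (only-three (G u) (Cubic.regular cub u) i≢j i≢k j≢k ui uj uk)

another-neighbour : {G : Graph n} → Cubic G → ∀ u i j → ∃ λ k → Edge G u k × k ≢ i × k ≢ j
another-neighbour {G = G} cub u = third-member (G u) (Cubic.regular cub u)

non-neighbour : {G : Graph n} {u i j k l : Fin n} → NeighboursAre G u i j k →
                l ≢ i → l ≢ j → l ≢ k → ¬ Edge G u l
non-neighbour {l = l} N l≢i l≢j l≢k e with NeighboursAre.among N l e
... | inj₁ l≡i = l≢i l≡i
... | inj₂ (inj₁ l≡j) = l≢j l≡j
... | inj₂ (inj₂ l≡k) = l≢k l≡k

-- A vertex adjacent to something outside N(u) is not u; this is how most
-- distinctness facts below are obtained.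
not-centre : {G : Graph n} {u i j k x l : Fin n} → NeighboursAre G u i j k →
             Edge G x l → l ≢ i → l ≢ j → l ≢ k → x ≢ u
not-centre N e l≢i l≢j l≢k refl = non-neighbour N l≢i l≢j l≢k e

record TippedDiamond (G : Graph n) (a b c d : Fin n) : Set where
  constructor tipped
  field
    a≢b : a ≢ b
    a≢c : a ≢ c
    a≢d : a ≢ d
    b≢c : b ≢ c
    b≢d : b ≢ d
    c≢d : c ≢ d
    ac : Edge G a c
    ad : Edge G a d
    bc : Edge G b c
    bd : Edge G b d
    cd : Edge G c d
    ¬ab : ¬ Edge G a b

Complete : Graph n → (a b c d : Fin n) → Set
Complete G a b c d = Edge G a b × Edge G a c × Edge G a d × Edge G b c × Edge G b d × Edge G c d

-- Neighbours a′ of a and b′ of b off the spine that can be joined by an edge: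
-- then one make move turns the diamond into K₄.
record Exits (G : Graph n) (a b c d : Fin n) : Set where
  field
    a′ b′ : Fin n
    aa′ : Edge G a a′
    bb′ : Edge G b b′
    a′≢c : a′ ≢ c
    a′≢d : a′ ≢ d
    b′≢c : b′ ≢ c
    b′≢d : b′ ≢ d
    a′≢b′ : a′ ≢ b′
    ¬a′b′ : ¬ Edge G a′ b′

join-tips : {G : Graph n} {a b c d : Fin n} → Cubic G → TippedDiamond G a b c d → Exits G a b c d →
            Σ (Graph n) λ G′ → Cubic G′ × Move G G′ × Complete G′ a b c d
join-tips {n = n} {G = G} {a} {b} cub D X =
  G′ , proj₁ step , proj₂ step ,
  inserted₁ , kept ac (≢pairʳ c≢a c≢a′) (≢pairˡ a≢b a≢b′) , kept ad (≢pairʳ d≢a d≢a′) (≢pairˡ a≢b a≢b′) ,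
  kept bc (≢pairˡ b≢a b≢a′) (≢pairʳ c≢b c≢b′) , kept bd (≢pairˡ b≢a b≢a′) (≢pairʳ d≢b d≢b′) ,
  kept cd (≢pairˡ c≢a c≢a′) (≢pairˡ c≢b c≢b′)
  where
  open TippedDiamond D
  open Exits X
  G′ : Graph n
  G′ = switch G a a′ b b′
  open SwitchFacts G G′ (switch-spec G a a′ b b′)
  b≢a = ≢-sym a≢b
  c≢a = ≢-sym a≢c
  c≢b = ≢-sym b≢c
  d≢a = ≢-sym a≢d
  d≢b = ≢-sym b≢d
  c≢a′ = ≢-sym a′≢c
  c≢b′ = ≢-sym b′≢c
  d≢a′ = ≢-sym a′≢d
  d≢b′ = ≢-sym b′≢d
  a≢a′ = edge-≢ cub aa′
  b≢b′ = edge-≢ cub bb′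
  b≢a′ : b ≢ a′
  b≢a′ refl = ¬ab aa′
  a≢b′ : a ≢ b′
  a≢b′ refl = ¬ab (edge-sym cub bb′)
  step : Cubic G′ × Move G G′
  step = make cub (≢-sym a≢a′ , a′≢c , ≢-sym b≢a′ , a′≢b′ , a≢c , a≢b , a≢b′ , c≢b , c≢b′ , b≢b′)
              (edge-sym cub aa′) ac (edge-sym cub bc) bb′ ¬ab ¬a′b′

Outside : (a b c d x : Fin n) → Set
Outside a b c d x = a ≢ x × b ≢ x × c ≢ x × d ≢ x

-- A move make(y x v w z) with x, w, z outside the diamond deletes and inserts
-- no pair of diamond vertices, so the diamond survives it.
diamond-survives : {G H : Graph n} {a b c d x y w z : Fin n} → Switched G H x y w z x w y z →
                   Outside a b c d x → Outside a b c d w → Outside a b c d z →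
                   TippedDiamond G a b c d → TippedDiamond H a b c d
diamond-survives {G = G} {H} {x = x} {w = w} S (a≢x , b≢x , c≢x , d≢x) (a≢w , b≢w , c≢w , d≢w) (a≢z , b≢z , _ , _) D =
  record
    { a≢b = a≢b ; a≢c = a≢c ; a≢d = a≢d ; b≢c = b≢c ; b≢d = b≢d ; c≢d = c≢d
    ; ac = survives a≢x c≢x a≢w c≢w ac
    ; ad = survives a≢x d≢x a≢w d≢w ad
    ; bc = survives b≢x c≢x b≢w c≢w bc
    ; bd = survives b≢x d≢x b≢w d≢w bd
    ; cd = survives c≢x d≢x c≢w d≢w cd
    ; ¬ab = absent ¬ab (≢pair-fst a≢x b≢x) (≢pair-snd a≢z b≢z)
    }
  where
  open TippedDiamond D
  open SwitchFacts G H S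
  survives : ∀ {u v} → u ≢ x → v ≢ x → u ≢ w → v ≢ w → Edge G u v → Edge H u v
  survives u≢x v≢x u≢w v≢w e = kept e (≢pair-fst u≢x v≢x) (≢pair-fst u≢w v≢w)

module Neighbourhoods {G : Graph n} {a b c d : Fin n} (cub : Cubic G) (D : TippedDiamond G a b c d) where
  open TippedDiamond D

  N-c : NeighboursAre G c a b d
  N-c = neighbours cub c a≢b a≢d b≢d (edge-sym cub ac) (edge-sym cub bc) cd

  N-d : NeighboursAre G d a b c
  N-d = neighbours cub d a≢b a≢c b≢c (edge-sym cub ad) (edge-sym cub bd) (edge-sym cub cd)

  N-a : ∀ {a′} → Edge G a a′ → a′ ≢ c → a′ ≢ d → NeighboursAre G a c d a′
  N-a aa′ a′≢c a′≢d = neighbours cub a c≢d (≢-sym a′≢c) (≢-sym a′≢d) ac ad aa′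

  N-b : ∀ {b′} → Edge G b b′ → b′ ≢ c → b′ ≢ d → NeighboursAre G b c d b′
  N-b bb′ b′≢c b′≢d = neighbours cub b c≢d (≢-sym b′≢c) (≢-sym b′≢d) bc bd bb′

Prepared : Graph n → (a b c d : Fin n) → Set
Prepared {n} G a b c d = Σ (Graph n) λ H → Cubic H × Move G H × TippedDiamond H a b c d × Exits H a b c d

-- Tips with a common outer neighbour p: follow a path p r s t leading away
-- from the diamond and apply make(b p r s t), which replaces bp, st by ps, bt.
-- Afterwards a still exits through p while b exits through t.
shared-exit : {G : Graph n} {a b c d p : Fin n} → Cubic G → TippedDiamond G a b c d →
              Edge G a p → Edge G b p → p ≢ c → p ≢ d →
              Prepared G a b c d
shared-exit {n = n} {G = G} {a} {b} {p = p} cub D ap bp p≢c p≢d with another-neighbour cub p a b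
... | r , pr , r≢a , r≢b with another-neighbour cub r p p
... | s , rs , s≢p , _ with another-neighbour cub s r r
... | t , st , t≢r , _ =
  H , proj₁ step , proj₂ step ,
  diamond-survives S (≢-sym p≢a , ≢-sym p≢b , ≢-sym p≢c , ≢-sym p≢d)
                     (≢-sym s≢a , ≢-sym s≢b , ≢-sym s≢c , ≢-sym s≢d)
                     (≢-sym t≢a , ≢-sym t≢b , ≢-sym t≢c , ≢-sym t≢d) D ,
  record { a′ = p ; b′ = t
         ; aa′ = kept ap (≢pairˡ (edge-≢ cub ap) a≢b) (≢pairˡ (≢-sym s≢a) (≢-sym t≢a))
         ; bb′ = inserted₂
         ; a′≢c = p≢c ; a′≢d = p≢d ; b′≢c = t≢c ; b′≢d = t≢d ; a′≢b′ = ≢-sym t≢p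
         ; ¬a′b′ = absent (non-neighbour N-p t≢a t≢b t≢r) (≢pairʳ t≢p t≢s) (≢pairˡ p≢b (≢-sym t≢p)) }
  where
  open TippedDiamond D
  open Neighbourhoods cub D
  H : Graph n
  H = switch G p b s t
  S : Switched G H p b s t p s b t
  S = switch-spec G p b s t
  open SwitchFacts G H S
  N-p : NeighboursAre G p a b r
  N-p = neighbours cub p a≢b (≢-sym r≢a) (≢-sym r≢b) (edge-sym cub ap) (edge-sym cub bp) pr
  -- Each vertex of the path p r s t is adjacent to its predecessor, which lies
  -- outside N(x) for the diamond vertices x and for p; hence it differs from them.
  p≢a = ≢-sym (edge-≢ cub ap)
  p≢b = ≢-sym (edge-≢ cub bp)
  r≢p = ≢-sym (edge-≢ cub pr)
  r≢c = not-centre N-c (edge-sym cub pr) p≢a p≢b p≢d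
  r≢d = not-centre N-d (edge-sym cub pr) p≢a p≢b p≢c
  s≢r = ≢-sym (edge-≢ cub rs)
  s≢a = not-centre (N-a ap p≢c p≢d) (edge-sym cub rs) r≢c r≢d r≢p
  s≢b = not-centre (N-b bp p≢c p≢d) (edge-sym cub rs) r≢c r≢d r≢p
  s≢c = not-centre N-c (edge-sym cub rs) r≢a r≢b r≢d
  s≢d = not-centre N-d (edge-sym cub rs) r≢a r≢b r≢c
  t≢s = ≢-sym (edge-≢ cub st)
  t≢a = not-centre (N-a ap p≢c p≢d) (edge-sym cub st) s≢c s≢d s≢p
  t≢b = not-centre (N-b bp p≢c p≢d) (edge-sym cub st) s≢c s≢d s≢p
  t≢c = not-centre N-c (edge-sym cub st) s≢a s≢b s≢d
  t≢d = not-centre N-d (edge-sym cub st) s≢a s≢b s≢c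
  t≢p = not-centre N-p (edge-sym cub st) s≢a s≢b s≢r
  step : Cubic H × Move G H
  step = make cub (≢-sym p≢b , ≢-sym r≢b , ≢-sym s≢b , ≢-sym t≢b , ≢-sym r≢p ,
                   ≢-sym s≢p , ≢-sym t≢p , ≢-sym s≢r , ≢-sym t≢r , ≢-sym t≢s)
              bp pr rs st (non-neighbour N-p s≢a s≢b s≢r) (non-neighbour (N-b bp p≢c p≢d) t≢c t≢d t≢p)

-- Let N(u) = {i, j, q} and s ∉ {i, j}. Then s has a neighbour t ≠ p outside
-- {u, q}: if s = q any neighbour t ∉ {p, u} will do, otherwise s is not
-- adjacent to u and we may avoid p and q.
neighbour-outside : {G : Graph n} {u i j q s : Fin n} → Cubic G → NeighboursAre G u i j q →
                    s ≢ i → s ≢ j → ∀ p → ∃ λ t → Edge G s t × t ≢ p × t ≢ u × t ≢ q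
neighbour-outside {u = u} {q = q} {s} cub N s≢i s≢j p with s ≟ q
... | yes refl = let (t , st , t≢p , t≢u) = another-neighbour cub s p u in t , st , t≢p , t≢u , ≢-sym (edge-≢ cub st)
... | no s≢q = let (t , st , t≢p , t≢q) = another-neighbour cub s p q in
               t , st , t≢p , not-centre N (edge-sym cub st) s≢i s≢j s≢q , t≢q

-- Adjacent outer neighbours a′ ~ b′: with p the third neighbour of a′, choose
-- a path a′ p s t leading away from the diamond, with t not a neighbour of b′,
-- and apply make(b′ a′ p s t), which replaces a′b′, st by a′s, b′t.
-- Afterwards a′ and b′ are distinct non-adjacent exits.
adjacent-exits : {G : Graph n} {a b c d a′ b′ : Fin n} → Cubic G → TippedDiamond G a b c d →
                 Edge G a a′ → Edge G b b′ → a′ ≢ c → a′ ≢ d → b′ ≢ c → b′ ≢ d → a′ ≢ b′ → Edge G a′ b′ →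
                 Prepared G a b c d
adjacent-exits {n = n} {G = G} {a} {b} {c} {d} {a′} {b′} cub D aa′ bb′ a′≢c a′≢d b′≢c b′≢d a′≢b′ a′b′
  with another-neighbour cub a′ a b′ | another-neighbour cub b′ b a′
... | p , a′p , p≢a , p≢b′ | q , b′q , q≢b , q≢a′ with another-neighbour cub p a′ b′
... | s , ps , s≢a′ , s≢b′ = switch-along (neighbour-outside cub N-b′ s≢b s≢a′ p)
  where
  open TippedDiamond D
  open Neighbourhoods cub D
  a′≢a = ≢-sym (edge-≢ cub aa′)
  b′≢b = ≢-sym (edge-≢ cub bb′)
  a′≢b : a′ ≢ b
  a′≢b refl = ¬ab aa′
  b′≢a : b′ ≢ a
  b′≢a refl = ¬ab (edge-sym cub bb′)
  N-a′ : NeighboursAre G a′ a b′ p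
  N-a′ = neighbours cub a′ (≢-sym b′≢a) (≢-sym p≢a) (≢-sym p≢b′) (edge-sym cub aa′) a′b′ a′p
  N-b′ : NeighboursAre G b′ b a′ q
  N-b′ = neighbours cub b′ (≢-sym a′≢b) (≢-sym q≢b) (≢-sym q≢a′) (edge-sym cub bb′) (edge-sym cub a′b′) b′q
  -- As in shared-exit, each vertex of the path a′ p s t differs from the
  -- diamond vertices because its predecessor lies outside their neighbourhoods.
  p≢a′ = ≢-sym (edge-≢ cub a′p)
  p≢b = not-centre (N-b bb′ b′≢c b′≢d) (edge-sym cub a′p) a′≢c a′≢d a′≢b′
  p≢c = not-centre N-c (edge-sym cub a′p) a′≢a a′≢b a′≢d
  p≢d = not-centre N-d (edge-sym cub a′p) a′≢a a′≢b a′≢c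
  s≢p = ≢-sym (edge-≢ cub ps)
  s≢a = not-centre (N-a aa′ a′≢c a′≢d) (edge-sym cub ps) p≢c p≢d p≢a′
  s≢b = not-centre (N-b bb′ b′≢c b′≢d) (edge-sym cub ps) p≢c p≢d p≢b′
  s≢c = not-centre N-c (edge-sym cub ps) p≢a p≢b p≢d
  s≢d = not-centre N-d (edge-sym cub ps) p≢a p≢b p≢c

  switch-along : (∃ λ t → Edge G s t × t ≢ p × t ≢ b′ × t ≢ q) →
                 Prepared G a b c d
  switch-along (t , st , t≢p , t≢b′ , t≢q) =
    H , proj₁ step , proj₂ step ,
    diamond-survives S (≢-sym a′≢a , ≢-sym a′≢b , ≢-sym a′≢c , ≢-sym a′≢d)
                       (≢-sym s≢a , ≢-sym s≢b , ≢-sym s≢c , ≢-sym s≢d)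
                       (≢-sym t≢a , ≢-sym t≢b , ≢-sym t≢c , ≢-sym t≢d) D ,
    record { a′ = a′ ; b′ = b′
           ; aa′ = kept aa′ (≢pairˡ (≢-sym a′≢a) (≢-sym b′≢a)) (≢pairˡ (≢-sym s≢a) (≢-sym t≢a))
           ; bb′ = kept bb′ (≢pairˡ (≢-sym a′≢b) (≢-sym b′≢b)) (≢pairˡ (≢-sym s≢b) (≢-sym t≢b))
           ; a′≢c = a′≢c ; a′≢d = a′≢d ; b′≢c = b′≢c ; b′≢d = b′≢d ; a′≢b′ = a′≢b′
           ; ¬a′b′ = deleted₁ (≢pairʳ (≢-sym a′≢b′) (≢-sym s≢b′)) (≢pairˡ a′≢b′ (≢-sym t≢a′)) }
    where
    H : Graph n
    H = switch G a′ b′ s t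
    S : Switched G H a′ b′ s t a′ s b′ t
    S = switch-spec G a′ b′ s t
    open SwitchFacts G H S
    t≢s = ≢-sym (edge-≢ cub st)
    t≢a′ = not-centre N-a′ (edge-sym cub st) s≢a s≢b′ s≢p
    t≢a = not-centre (N-a aa′ a′≢c a′≢d) (edge-sym cub st) s≢c s≢d s≢a′
    t≢b = not-centre (N-b bb′ b′≢c b′≢d) (edge-sym cub st) s≢c s≢d s≢b′
    t≢c = not-centre N-c (edge-sym cub st) s≢a s≢b s≢d
    t≢d = not-centre N-d (edge-sym cub st) s≢a s≢b s≢c
    step : Cubic H × Move G H
    step = make cub (≢-sym a′≢b′ , ≢-sym p≢b′ , ≢-sym s≢b′ , ≢-sym t≢b′ , ≢-sym p≢a′ , ≢-sym s≢a′ , ≢-sym t≢a′ ,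
                     ≢-sym s≢p , ≢-sym t≢p , ≢-sym t≢s)
                (edge-sym cub a′b′) a′p ps st (non-neighbour N-a′ s≢a s≢b′ s≢p) (non-neighbour N-b′ t≢b t≢a′ t≢q)

Completion : Graph n → (a b c d : Fin n) → Set
Completion {n} G a b c d = Σ (Graph n) λ G′ → Cubic G′ × PathLe2 G G′ × Complete G′ a b c d

prepared-completion : {G : Graph n} {a b c d : Fin n} → Prepared G a b c d → Completion G a b c d
prepared-completion (H , cubH , G→H , D , X) =
  let (G′ , cub′ , H→G′ , K) = join-tips cubH D X in G′ , cub′ , inj₂ (inj₂ (H , cubH , G→H , H→G′)) , K

complete-diamond : {G : Graph n} {a b c d : Fin n} → Cubic G → TippedDiamond G a b c d → Completion G a b c d
complete-diamond {G = G} {a} {b} {c} {d} cub D with another-neighbour cub a c d | another-neighbour cub b c d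
... | a′ , aa′ , a′≢c , a′≢d | b′ , bb′ , b′≢c , b′≢d with a′ ≟ b′
... | yes refl = prepared-completion {G = G} (shared-exit cub D aa′ bb′ a′≢c a′≢d)
... | no a′≢b′ with lookup (G a′) b′ ≟ᵇ true
...   | yes a′b′ = prepared-completion {G = G} (adjacent-exits cub D aa′ bb′ a′≢c a′≢d b′≢c b′≢d a′≢b′ a′b′)
...   | no ¬a′b′ =
  let (G′ , cub′ , G→G′ , K) = join-tips cub D (record { a′ = a′ ; b′ = b′ ; aa′ = aa′ ; bb′ = bb′
                                                      ; a′≢c = a′≢c ; a′≢d = a′≢d ; b′≢c = b′≢c ; b′≢d = b′≢d
                                                      ; a′≢b′ = a′≢b′ ; ¬a′b′ = ¬a′b′ })
  in G′ , cub′ , inj₂ (inj₁ G→G′) , K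

k4-component : {G : Graph n} {v w x y : Fin n} → Cubic G → Distinct4 v w x y →
               Complete G v w x y → K4Component G v w x y
k4-component {G = G} {v} {w} {x} {y} cub dist@(v≢w , v≢x , v≢y , w≢x , w≢y , x≢y) (vw , vx , vy , wx , wy , xy) =
  dist , vw , vx , vy , wx , wy , xy , closed
  where
  closed : ∀ a b → InQuad v w x y a → Edge G a b → InQuad v w x y b
  closed _ b (inj₁ refl) e =
    inj₂ (NeighboursAre.among (neighbours cub v w≢x w≢y x≢y vw vx vy) b e)
  closed _ b (inj₂ (inj₁ refl)) e =
    map₂ inj₂ (NeighboursAre.among (neighbours cub w v≢x v≢y x≢y (edge-sym cub vw) wx wy) b e)
  closed _ b (inj₂ (inj₂ (inj₁ refl))) e =
    map₂ (map₂ inj₂) (NeighboursAre.among (neighbours cub x v≢w v≢y w≢y (edge-sym cub vx) (edge-sym cub wx) xy) b e)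
  closed _ b (inj₂ (inj₂ (inj₂ refl))) e =
    map₂ (map₂ inj₁) (NeighboursAre.among (neighbours cub y v≢w v≢x w≢x (edge-sym cub vy) (edge-sym cub wy) (edge-sym cub xy)) b e)

relabel : {G : Graph n} {a b c d v w x y : Fin n} → Completion G a b c d →
          (∀ {G′} → Cubic G′ → Complete G′ a b c d → Complete G′ v w x y) → Completion G v w x y
relabel (G′ , cub′ , path , K) reorder = G′ , cub′ , path , reorder cub′ K

-- The diamond on v, w, x, y whose missing pair is the i-th pair listed by
-- pairBits (vw, vx, vy, wx, wy, xy) is completed, with that pair as tips and
-- the other two vertices as spine.
complete-missing : {G : Graph n} {v w x y : Fin n} → Cubic G → Distinct4 v w x y → (i : Fin 6) →
                   lookup (pairBits G v w x y) i ≡ false →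
                   (∀ j → j ≢ i → lookup (pairBits G v w x y) j ≡ true) → Completion G v w x y
complete-missing cub (v≢w , v≢x , v≢y , w≢x , w≢y , x≢y) zero missing present =
  complete-diamond cub (tipped v≢w v≢x v≢y w≢x w≢y x≢y
    (present (# 1) λ ()) (present (# 2) λ ()) (present (# 3) λ ())
    (present (# 4) λ ()) (present (# 5) λ ()) (not-¬ missing))
complete-missing {G = G} cub (v≢w , v≢x , v≢y , w≢x , w≢y , x≢y) (suc zero) missing present =
  relabel {G = G}
    (complete-diamond cub (tipped v≢x v≢w v≢y (≢-sym w≢x) x≢y w≢y
      (present (# 0) λ ()) (present (# 2) λ ()) (edge-sym cub (present (# 3) λ ()))
      (present (# 5) λ ()) (present (# 4) λ ()) (not-¬ missing)))
    λ cub′ (vx , vw , vy , xw , xy , wy) → vw , vx , vy , edge-sym cub′ xw , wy , xy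
complete-missing {G = G} cub (v≢w , v≢x , v≢y , w≢x , w≢y , x≢y) (suc (suc zero)) missing present =
  relabel {G = G}
    (complete-diamond cub (tipped v≢y v≢w v≢x (≢-sym w≢y) (≢-sym x≢y) w≢x
      (present (# 0) λ ()) (present (# 1) λ ()) (edge-sym cub (present (# 4) λ ()))
      (edge-sym cub (present (# 5) λ ())) (present (# 3) λ ()) (not-¬ missing)))
    λ cub′ (vy , vw , vx , yw , yx , wx) → vw , vx , vy , wx , edge-sym cub′ yw , edge-sym cub′ yx
complete-missing {G = G} cub (v≢w , v≢x , v≢y , w≢x , w≢y , x≢y) (suc (suc (suc zero))) missing present =
  relabel {G = G}
    (complete-diamond cub (tipped w≢x (≢-sym v≢w) w≢y (≢-sym v≢x) x≢y v≢y
      (edge-sym cub (present (# 0) λ ())) (present (# 4) λ ()) (edge-sym cub (present (# 1) λ ()))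
      (present (# 5) λ ()) (present (# 2) λ ()) (not-¬ missing)))
    λ cub′ (wx , wv , wy , xv , xy , vy) → edge-sym cub′ wv , edge-sym cub′ xv , vy , wx , wy , xy
complete-missing {G = G} cub (v≢w , v≢x , v≢y , w≢x , w≢y , x≢y) (suc (suc (suc (suc zero)))) missing present =
  relabel {G = G}
    (complete-diamond cub (tipped w≢y (≢-sym v≢w) w≢x (≢-sym v≢y) (≢-sym x≢y) v≢x
      (edge-sym cub (present (# 0) λ ())) (present (# 3) λ ()) (edge-sym cub (present (# 2) λ ()))
      (edge-sym cub (present (# 5) λ ())) (present (# 1) λ ()) (not-¬ missing)))
    λ cub′ (wy , wv , wx , yv , yx , vx) → edge-sym cub′ wv , vx , edge-sym cub′ yv , wx , wy , edge-sym cub′ yx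
complete-missing {G = G} cub (v≢w , v≢x , v≢y , w≢x , w≢y , x≢y) (suc (suc (suc (suc (suc zero))))) missing present =
  relabel {G = G}
    (complete-diamond cub (tipped x≢y (≢-sym v≢x) (≢-sym w≢x) (≢-sym v≢y) (≢-sym w≢y) v≢w
      (edge-sym cub (present (# 1) λ ())) (edge-sym cub (present (# 3) λ ()))
      (edge-sym cub (present (# 2) λ ())) (edge-sym cub (present (# 4) λ ())) (present (# 0) λ ()) (not-¬ missing)))
    λ cub′ (xy , xv , xw , yv , yw , vw) →
      vw , edge-sym cub′ xv , edge-sym cub′ yv , edge-sym cub′ xw , edge-sym cub′ yw , xy

lemma7 : (n : ℕ) → 4 ≤ n → 2 ∣ n → (G : Graph n) → Cubic G →
         (v w x y : Fin n) → Diamond G v w x y →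
         Σ (Graph n) λ G' → Cubic G' × PathLe2 G G' × K4Component G' v w x y
lemma7 n _ _ G cub v w x y (distinct , five-edges) =
  let (i , missing , present) = single-zero (pairBits G v w x y) five-edges
      (G′ , cub′ , path , complete) = complete-missing cub distinct i missing present
  in G′ , cub′ , path , k4-component cub′ distinct complete
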